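{- The logic $\mathsf{sICL}:=\mathsf{ICK}\oplus(q\to(p>q))\oplus((p>(p>q))\to(p>q))$ is sound and complete with respect to the class of conditional Kripke frames $(X,\le,\mathcal R)$ such that for all $x,y\in X$ and all upsets $a$: if $xR_ay$ then $x\le y$; and if $xR_ay$ then there are $u,v$ with $xR_au$, $uR_av$ and $v\le y$.
   Context: Formulas: $\phi::=p\mid\bot\mid\phi\wedge\phi\mid\phi\vee\phi\mid\phi\to\phi\mid\phi>\phi$, $\top:=\bot\to\bot$. $\mathsf{ICK}\oplus\Gamma$ is the smallest set of formulas containing the axioms of intuitionistic propositional logic, $\Gamma$, $(p>(q\wedge r))\leftrightarrow((p>q)\wedge(p>r))$ and $(p>\top)\leftrightarrow\top$, closed under uniform substitution, modus ponens and: from $\phi\leftrightarrow\psi$ infer $(\phi>\chi)\leftrightarrow(\psi>\chi)$ and $(\chi>\phi)\leftrightarrow(\chi>\psi)$. A conditional Kripke frame is $(X,\le,\mathcal R)$, $(X,\le)$ a nonempty preorder, $\mathcal R=\{R_a: a\text{ upset}\}$ such that $x\le yR_az$ implies $xR_aw\le z$ for some $w$. Valuations map variables to upsets; intuitionistic Kripke clauses and $x\models\phi>\psi$ iff every $y$ with $xR_{V(\phi)}y$ satisfies $\psi$. Sound and complete: the logic's members are exactly the formulas valid on all frames in the class. -}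

module Defs where

open import Data.Nat using (ℕ)
open import Data.Product using (Σ; _×_; _,_; ∃-syntax)
open import Data.Sum using (_⊎_; inj₁; inj₂)
open import Data.Empty using (⊥)
open import Data.Unit using (⊤)

infixr 6 _∧'_
infixr 5 _∨'_
infixr 4 _⇒_ _▷_

data Formula : Set where
  var  : ℕ → Formula
  ⊥'   : Formula
  _∧'_ : Formula → Formula → Formula
  _∨'_ : Formula → Formula → Formula
  _⇒_  : Formula → Formula → Formula
  _▷_  : Formula → Formula → Formula

⊤' : Formula
⊤' = ⊥' ⇒ ⊥'

_⇔'_ : Formula → Formula → Formula
φ ⇔' ψ = (φ ⇒ ψ) ∧' (ψ ⇒ φ)

p q r : Formula
p = var 0
q = var 1
r = var 2

Subst : Set
Subst = ℕ → Formula

_[_] : Formula → Subst → Formula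
var n    [ σ ] = σ n
⊥'       [ σ ] = ⊥'
(φ ∧' ψ) [ σ ] = (φ [ σ ]) ∧' (ψ [ σ ])
(φ ∨' ψ) [ σ ] = (φ [ σ ]) ∨' (ψ [ σ ])
(φ ⇒ ψ)  [ σ ] = (φ [ σ ]) ⇒ (ψ [ σ ])
(φ ▷ ψ)  [ σ ] = (φ [ σ ]) ▷ (ψ [ σ ])

data IPCAxiom : Formula → Set where
  ax-K     : IPCAxiom (p ⇒ (q ⇒ p))
  ax-S     : IPCAxiom ((p ⇒ (q ⇒ r)) ⇒ ((p ⇒ q) ⇒ (p ⇒ r)))
  ax-∧E₁   : IPCAxiom ((p ∧' q) ⇒ p)
  ax-∧E₂   : IPCAxiom ((p ∧' q) ⇒ q)
  ax-∧I    : IPCAxiom (p ⇒ (q ⇒ (p ∧' q)))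
  ax-∨I₁   : IPCAxiom (p ⇒ (p ∨' q))
  ax-∨I₂   : IPCAxiom (q ⇒ (p ∨' q))
  ax-∨E    : IPCAxiom ((p ⇒ r) ⇒ ((q ⇒ r) ⇒ ((p ∨' q) ⇒ r)))
  ax-efq   : IPCAxiom (⊥' ⇒ p)

data ICKAxiom : Formula → Set where
  ax-C∧ : ICKAxiom ((p ▷ (q ∧' r)) ⇔' ((p ▷ q) ∧' (p ▷ r)))
  ax-C⊤ : ICKAxiom ((p ▷ ⊤') ⇔' ⊤')

data sICLAxiom : Formula → Set where
  ax-1 : sICLAxiom (q ⇒ (p ▷ q))
  ax-2 : sICLAxiom ((p ▷ (p ▷ q)) ⇒ (p ▷ q))

data ICK⊕ (Γ : Formula → Set) : Formula → Set where
  ipc   : ∀ {φ} → IPCAxiom φ → ICK⊕ Γ φ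
  extra : ∀ {φ} → Γ φ → ICK⊕ Γ φ
  ick   : ∀ {φ} → ICKAxiom φ → ICK⊕ Γ φ
  usubst : ∀ {φ} (σ : Subst) → ICK⊕ Γ φ → ICK⊕ Γ (φ [ σ ])
  mp    : ∀ {φ ψ} → ICK⊕ Γ (φ ⇒ ψ) → ICK⊕ Γ φ → ICK⊕ Γ ψ
  congˡ : ∀ {φ ψ χ} → ICK⊕ Γ (φ ⇔' ψ) → ICK⊕ Γ ((φ ▷ χ) ⇔' (ψ ▷ χ))
  congʳ : ∀ {φ ψ χ} → ICK⊕ Γ (φ ⇔' ψ) → ICK⊕ Γ ((χ ▷ φ) ⇔' (χ ▷ ψ))

sICL : Formula → Set
sICL = ICK⊕ sICLAxiom

record Upset {X : Set} (_≤_ : X → X → Set) : Set₁ where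
  constructor mkUpset
  field
    pred : X → Set
    up   : ∀ {x y} → x ≤ y → pred x → pred y

record Frame : Set₁ where
  field
    X     : Set
    _≤_   : X → X → Set
    ≤-refl  : ∀ {x} → x ≤ x
    ≤-trans : ∀ {x y z} → x ≤ y → y ≤ z → x ≤ z
    inhabitant : X
  field
    R : Upset _≤_ → X → X → Set
    -- R is indexed by upsets as *sets*: extensionally equal upsets give the same relation
    R-ext : ∀ (a b : Upset _≤_) → (∀ x → Upset.pred a x → Upset.pred b x)
                            → (∀ x → Upset.pred b x → Upset.pred a x)
                            → ∀ {x y} → R a x y → R b x y
    R-back : ∀ a {x y z} → x ≤ y → R a y z → ∃[ w ] (R a x w × w ≤ z)

module Sem (F : Frame) where
  open Frame F

  Valuation : Set₁
  Valuation = ℕ → Upset _≤_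

  module _ (V : Valuation) where
    mutual
      _⊨_ : X → Formula → Set
      x ⊨ var n    = Upset.pred (V n) x
      x ⊨ ⊥'       = ⊥
      x ⊨ (φ ∧' ψ) = (x ⊨ φ) × (x ⊨ ψ)
      x ⊨ (φ ∨' ψ) = (x ⊨ φ) ⊎ (x ⊨ ψ)
      x ⊨ (φ ⇒ ψ)  = ∀ y → x ≤ y → y ⊨ φ → y ⊨ ψ
      x ⊨ (φ ▷ ψ)  = ∀ y → R (⟦ φ ⟧) x y → y ⊨ ψ

      ⟦_⟧ : Formula → Upset _≤_
      ⟦ φ ⟧ = mkUpset (λ x → x ⊨ φ) (persist φ)

      persist : ∀ φ {x y} → x ≤ y → x ⊨ φ → y ⊨ φ
      persist (var n)  x≤y h = Upset.up (V n) x≤y h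
      persist ⊥'       x≤y ()
      persist (φ ∧' ψ) x≤y (h₁ , h₂) = persist φ x≤y h₁ , persist ψ x≤y h₂
      persist (φ ∨' ψ) x≤y (inj₁ h) = inj₁ (persist φ x≤y h)
      persist (φ ∨' ψ) x≤y (inj₂ h) = inj₂ (persist ψ x≤y h)
      persist (φ ⇒ ψ)  x≤y h z y≤z hφ = h z (≤-trans x≤y y≤z) hφ
      persist (φ ▷ ψ)  x≤y h z yRz with R-back (⟦ φ ⟧) x≤y yRz
      ... | w , xRw , w≤z = persist ψ w≤z (h w xRw)

Valid : Frame → Formula → Set₁
Valid F φ = ∀ (V : Sem.Valuation F) (x : Frame.X F) → Sem._⊨_ F V x φ

record InClass (F : Frame) : Set₁ where
  open Frame F
  field
    R⊆≤   : ∀ a {x y} → R a x y → x ≤ y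
    R-dense : ∀ a {x y} → R a x y → ∃[ u ] ∃[ v ] (R a x u × R a u v × v ≤ y)

-- Soundness: axiom q → (p > q) holds because R_a ⊆ ≤ and truth is persistent, and
-- (p > (p > q)) → (p > q) holds because every R_a-step factors, up to ≤, through two R_a-steps.
--
-- Completeness (using excluded middle): the canonical frame consists of the prime theories ordered
-- by inclusion, with w R_a v iff a is the truth set of some φ and v contains every χ with φ > χ ∈ w.
-- The first axiom puts R_a inside inclusion. For density, extend {χ ∣ φ > χ ∈ w} to a prime theory u
-- avoiding {φ > χ ∣ χ ∉ v}: the second axiom makes this consistent, and then w R_a u R_a v.
-- Prime extensions come from a Lindenbaum construction along an enumeration of the formulas.

module Submission where

open import Defs
open import Axiom.ExcludedMiddle using (ExcludedMiddle)
open import Data.Bool using (Bool; T)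
open import Data.Empty using (⊥; ⊥-elim)
open import Data.Nat using (ℕ; zero; suc; _+_; _≤_; _⊔_; s≤s; _≤′_; ≤′-refl; ≤′-step)
import Data.Nat.Properties as Nat
open import Data.Nat.Properties
  using (+-suc; +-identityʳ; suc-injective; m≤m⊔n; m≤n⊔m; m⊔n≤o⇒m≤o; m⊔n≤o⇒n≤o; ≤⇒≤′)
import Data.Product as Product
open import Data.Product using (_×_; _,_; proj₁; proj₂; ∃-syntax; uncurry)
open import Data.Sum using (_⊎_; inj₁; inj₂; [_,_]′)
import Data.Sum as Sum
open import Data.Unit using (tt) renaming (⊤ to Unit)
open import Function.Base using (id; _∘_)
open import Function.Bundles using (_⇔_; mk⇔; Equivalence)
import Function.Properties.Equivalence as ⇔
open import Level using (0ℓ)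
open import Relation.Binary.PropositionalEquality using (_≡_; refl; cong; trans)
open import Relation.Nullary using (¬_; yes; no; isYes)
open import Relation.Nullary.Decidable using (toWitness; fromWitness; T?; decidable-stable)
open import Relation.Unary using (Pred; _∈_; _∉_; _⊆_; _∪_; ｛_｝; ∅; ⋃)

Theory : Set₁
Theory = Pred Formula 0ℓ

variable
  Γ Δ : Theory
  φ φ′ ψ χ δ : Formula

infix 2 _⊢_
data _⊢_ (Γ : Theory) : Formula → Set where
  hyp : φ ∈ Γ → Γ ⊢ φ
  thm : sICL φ → Γ ⊢ φ
  mp  : Γ ⊢ φ ⇒ ψ → Γ ⊢ φ → Γ ⊢ ψ

σ₃ : Formula → Formula → Formula → Subst
σ₃ a b c zero          = a
σ₃ a b c (suc zero)    = b
σ₃ a b c (suc (suc _)) = c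

ipc-instance : ∀ {θ} → IPCAxiom θ → ∀ a b c → Γ ⊢ θ [ σ₃ a b c ]
ipc-instance ax a b c = thm (usubst (σ₃ a b c) (ipc ax))

⇒-const : Γ ⊢ ψ → Γ ⊢ φ ⇒ ψ
⇒-const {ψ = ψ} {φ = φ} d = mp (ipc-instance ax-K ψ φ ψ) d

⇒-S : Γ ⊢ φ ⇒ ψ ⇒ χ → Γ ⊢ φ ⇒ ψ → Γ ⊢ φ ⇒ χ
⇒-S {φ = φ} {ψ} {χ} d e = mp (mp (ipc-instance ax-S φ ψ χ) d) e

⇒-id : Γ ⊢ φ ⇒ φ
⇒-id {φ = φ} = ⇒-S (ipc-instance ax-K φ (φ ⇒ φ) φ) (ipc-instance ax-K φ φ φ)

deduction : Γ ∪ ｛ φ ｝ ⊢ ψ → Γ ⊢ φ ⇒ ψ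
deduction (hyp (inj₁ ψ∈Γ)) = ⇒-const (hyp ψ∈Γ)
deduction (hyp (inj₂ refl)) = ⇒-id
deduction (thm t)           = ⇒-const (thm t)
deduction (mp d e)          = ⇒-S (deduction d) (deduction e)

weaken : Γ ⊆ Δ → Γ ⊢ φ → Δ ⊢ φ
weaken Γ⊆Δ (hyp φ∈Γ) = hyp (Γ⊆Δ φ∈Γ)
weaken Γ⊆Δ (thm t)   = thm t
weaken Γ⊆Δ (mp d e)  = mp (weaken Γ⊆Δ d) (weaken Γ⊆Δ e)

assumption : Γ ∪ ｛ φ ｝ ⊢ φ
assumption = hyp (inj₂ refl)

cut : Γ ⊢ φ → Γ ∪ ｛ φ ｝ ⊢ ψ → Γ ⊢ ψ
cut d e = mp (deduction e) d

⊢-theorem : ∅ ⊢ φ → sICL φ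
⊢-theorem (hyp ())
⊢-theorem (thm t)  = t
⊢-theorem (mp d e) = mp (⊢-theorem d) (⊢-theorem e)

∧-intro : Γ ⊢ φ → Γ ⊢ ψ → Γ ⊢ φ ∧' ψ
∧-intro {φ = φ} {ψ} d e = mp (mp (ipc-instance ax-∧I φ ψ φ) d) e

∧-elimˡ : Γ ⊢ φ ∧' ψ → Γ ⊢ φ
∧-elimˡ {φ = φ} {ψ} d = mp (ipc-instance ax-∧E₁ φ ψ φ) d

∧-elimʳ : Γ ⊢ φ ∧' ψ → Γ ⊢ ψ
∧-elimʳ {φ = φ} {ψ} d = mp (ipc-instance ax-∧E₂ φ ψ φ) d

∨-introˡ : Γ ⊢ φ → Γ ⊢ φ ∨' ψ
∨-introˡ {φ = φ} {ψ} d = mp (ipc-instance ax-∨I₁ φ ψ φ) d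

∨-introʳ : Γ ⊢ ψ → Γ ⊢ φ ∨' ψ
∨-introʳ {ψ = ψ} {φ} d = mp (ipc-instance ax-∨I₂ φ ψ φ) d

∨-elim : Γ ⊢ φ ∨' ψ → Γ ∪ ｛ φ ｝ ⊢ χ → Γ ∪ ｛ ψ ｝ ⊢ χ → Γ ⊢ χ
∨-elim {φ = φ} {ψ} {χ = χ} d e f =
  mp (mp (mp (ipc-instance ax-∨E φ ψ χ) (deduction e)) (deduction f)) d

ex-falso : Γ ⊢ ⊥' → Γ ⊢ φ
ex-falso {φ = φ} d = mp (ipc-instance ax-efq φ φ φ) d

ick-instance : ∀ {θ} → ICKAxiom θ → ∀ a b c → Γ ⊢ θ [ σ₃ a b c ]
ick-instance ax a b c = thm (usubst (σ₃ a b c) (ick ax))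

sICL-instance : ∀ {θ} → sICLAxiom θ → ∀ a b → Γ ⊢ θ [ σ₃ a b a ]
sICL-instance ax a b = thm (usubst (σ₃ a b a) (extra ax))

⇔-theorem : sICL (φ ⇒ ψ) → sICL (ψ ⇒ φ) → sICL (φ ⇔' ψ)
⇔-theorem t u = ⊢-theorem (∧-intro (thm t) (thm u))

▷-nec : sICL ψ → sICL (φ ▷ ψ)
▷-nec {ψ} {φ} t =
  ⊢-theorem (mp (∧-elimʳ (thm (congʳ ψ⇔⊤))) (mp (∧-elimʳ (ick-instance ax-C⊤ φ φ φ)) ⇒-id))
  where
  ψ⇔⊤ : sICL (ψ ⇔' ⊤')
  ψ⇔⊤ = ⇔-theorem (⊢-theorem (⇒-const ⇒-id)) (⊢-theorem (⇒-const (thm t)))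

▷-∧ : Γ ⊢ φ ▷ ψ → Γ ⊢ φ ▷ χ → Γ ⊢ φ ▷ (ψ ∧' χ)
▷-∧ {φ = φ} {ψ} {χ = χ} d e = mp (∧-elimʳ (ick-instance ax-C∧ φ ψ χ)) (∧-intro d e)

▷-mono : sICL (ψ ⇒ χ) → Γ ⊢ φ ▷ ψ → Γ ⊢ φ ▷ χ
▷-mono {ψ} {χ} {φ = φ} t d =
  ∧-elimʳ (mp (∧-elimˡ (ick-instance ax-C∧ φ ψ χ)) (mp (∧-elimˡ (thm (congʳ ψ⇔ψ∧χ))) d))
  where
  ψ⇔ψ∧χ : sICL (ψ ⇔' (ψ ∧' χ))
  ψ⇔ψ∧χ = ⇔-theorem (⊢-theorem (deduction (∧-intro assumption (mp (thm t) assumption))))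
                    (⊢-theorem (deduction (∧-elimˡ assumption)))

▷-∨ : Γ ⊢ (φ ▷ ψ) ∨' (φ ▷ χ) → Γ ⊢ φ ▷ (ψ ∨' χ)
▷-∨ d = ∨-elim d (▷-mono (⊢-theorem (deduction (∨-introˡ assumption))) assumption)
                 (▷-mono (⊢-theorem (deduction (∨-introʳ assumption))) assumption)

▷-congˡ : sICL (φ ⇔' φ′) → Γ ⊢ φ ▷ ψ → Γ ⊢ φ′ ▷ ψ
▷-congˡ t d = mp (∧-elimˡ (thm (congˡ t))) d

▷-intro : Γ ⊢ ψ → Γ ⊢ φ ▷ ψ
▷-intro {ψ = ψ} {φ} d = mp (sICL-instance ax-1 φ ψ) d

▷-idem : Γ ⊢ φ ▷ (φ ▷ ψ) → Γ ⊢ φ ▷ ψ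
▷-idem {φ = φ} {ψ} d = mp (sICL-instance ax-2 φ ψ) d

consequents : Formula → Theory → Theory
consequents φ Γ ψ = (φ ▷ ψ) ∈ Γ

consequents-⊢ : consequents φ Γ ⊢ ψ → Γ ⊢ φ ▷ ψ
consequents-⊢ (hyp φ▷ψ∈Γ) = hyp φ▷ψ∈Γ
consequents-⊢ (thm t)     = thm (▷-nec t)
consequents-⊢ (mp d e)    = ▷-mono modus-ponens (▷-∧ (consequents-⊢ d) (consequents-⊢ e))
  where
  modus-ponens : sICL ((ψ ⇒ χ) ∧' ψ ⇒ χ)
  modus-ponens = ⊢-theorem (deduction (mp (∧-elimˡ assumption) (∧-elimʳ assumption)))

-- Walks the diagonals of ℕ × ℕ: (0,0), (0,1), (1,0), (0,2), (1,1), (2,0), …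
next-on-diagonal : ℕ × ℕ → ℕ × ℕ
next-on-diagonal (a , suc b) = suc a , b
next-on-diagonal (a , zero)  = zero , suc a

unpair : ℕ → ℕ × ℕ
unpair zero    = zero , zero
unpair (suc n) = next-on-diagonal (unpair n)

unpair-surjective-on-diagonal : ∀ s a b → a + b ≡ s → ∃[ n ] unpair n ≡ (a , b)
unpair-surjective-on-diagonal _ zero zero _ = zero , refl
unpair-surjective-on-diagonal s (suc a) b a+b≡s
  with n , eq ← unpair-surjective-on-diagonal s a (suc b) (trans (+-suc a b) a+b≡s)
  = suc n , cong next-on-diagonal eq
unpair-surjective-on-diagonal (suc s) zero (suc b) b+1≡s+1
  with n , eq ← unpair-surjective-on-diagonal s b zero (trans (+-identityʳ b) (suc-injective b+1≡s+1))
  = suc n , cong next-on-diagonal eq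

pair : ℕ → ℕ → ℕ
pair a b = proj₁ (unpair-surjective-on-diagonal (a + b) a b refl)

unpair-pair : ∀ a b → unpair (pair a b) ≡ (a , b)
unpair-pair a b = proj₂ (unpair-surjective-on-diagonal (a + b) a b refl)

connective : ℕ → Formula → Formula → Formula
connective 0 = _∧'_
connective 1 = _∨'_
connective 2 = _⇒_
connective _ = _▷_

-- The fuel f bounds the height of the result; once it is used up, compound codes decode to ⊥'.
mutual
  decode : ℕ → ℕ → Formula
  decode f n = decode-node f (unpair n)

  decode-node : ℕ → ℕ × ℕ → Formula
  decode-node _       (0 , k)           = var k
  decode-node _       (1 , _)           = ⊥'
  decode-node zero    (suc (suc _) , _) = ⊥'
  decode-node (suc f) (suc (suc t) , k) =
    connective t (decode f (proj₁ (unpair k))) (decode f (proj₂ (unpair k)))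

decode-compound : ∀ f t i j →
                  decode (suc f) (pair (2 + t) (pair i j)) ≡ connective t (decode f i) (decode f j)
decode-compound f t i j rewrite unpair-pair (2 + t) (pair i j) | unpair-pair i j = refl

height : Formula → ℕ
height (var _)  = 0
height ⊥'       = 0
height (φ ∧' ψ) = suc (height φ ⊔ height ψ)
height (φ ∨' ψ) = suc (height φ ⊔ height ψ)
height (φ ⇒ ψ)  = suc (height φ ⊔ height ψ)
height (φ ▷ ψ)  = suc (height φ ⊔ height ψ)

compound-surjective : ∀ t {f φ ψ} → ∃[ i ] decode f i ≡ φ → ∃[ j ] decode f j ≡ ψ →
                      ∃[ n ] decode (suc f) n ≡ connective t φ ψ
compound-surjective t {f} (i , refl) (j , refl) = pair (2 + t) (pair i j) , decode-compound f t i j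

decode-surjective : ∀ φ {f} → height φ ≤ f → ∃[ n ] decode f n ≡ φ
decode-surjective (var k) {f} _ = pair 0 k , cong (decode-node f) (unpair-pair 0 k)
decode-surjective ⊥'      {f} _ = pair 1 0 , cong (decode-node f) (unpair-pair 1 0)
decode-surjective (φ ∧' ψ) (s≤s h) =
  compound-surjective 0 (decode-surjective φ (m⊔n≤o⇒m≤o _ _ h)) (decode-surjective ψ (m⊔n≤o⇒n≤o _ _ h))
decode-surjective (φ ∨' ψ) (s≤s h) =
  compound-surjective 1 (decode-surjective φ (m⊔n≤o⇒m≤o _ _ h)) (decode-surjective ψ (m⊔n≤o⇒n≤o _ _ h))
decode-surjective (φ ⇒ ψ) (s≤s h) =
  compound-surjective 2 (decode-surjective φ (m⊔n≤o⇒m≤o _ _ h)) (decode-surjective ψ (m⊔n≤o⇒n≤o _ _ h))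
decode-surjective (φ ▷ ψ) (s≤s h) =
  compound-surjective 3 (decode-surjective φ (m⊔n≤o⇒m≤o _ _ h)) (decode-surjective ψ (m⊔n≤o⇒n≤o _ _ h))

enumerate : ℕ → Formula
enumerate m = uncurry decode (unpair m)

enumerate-surjective : ∀ φ → ∃[ m ] enumerate m ≡ φ
enumerate-surjective φ with n , eq ← decode-surjective φ Nat.≤-refl =
  pair (height φ) n , trans (cong (uncurry decode) (unpair-pair (height φ) n)) eq

infix 4 _⊢⋁_
_⊢⋁_ : Theory → Theory → Set
Γ ⊢⋁ Δ = ∃[ δ ] δ ∈ Δ × (Γ ⊢ δ)

Directed : Theory → Set
Directed Δ = ∀ {δ₁ δ₂} → δ₁ ∈ Δ → δ₂ ∈ Δ → ∃[ δ ] δ ∈ Δ × sICL (δ₁ ∨' δ₂ ⇒ δ)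

｛｝-directed : Directed ｛ ψ ｝
｛｝-directed {ψ} refl refl = ψ , refl , ⊢-theorem (deduction (∨-elim assumption assumption assumption))

⊢⋁-｛｝ : Γ ⊢⋁ ｛ ψ ｝ → Γ ⊢ ψ
⊢⋁-｛｝ (_ , refl , d) = d

-- Membership is Bool-valued so that prime theories form a small type, as the carrier of a frame must.
record PrimeTheory : Set where
  field
    holds  : Formula → Bool
    closed : (T ∘ holds) ⊢ φ → T (holds φ)
    prime  : T (holds (φ ∨' ψ)) → T (holds φ) ⊎ T (holds ψ)
    ⊥-free : ¬ T (holds ⊥')

⌊_⌋ : PrimeTheory → Theory
⌊ w ⌋ φ = T (PrimeTheory.holds w φ)

record PrimeExtension (Γ Δ : Theory) : Set where
  field
    world   : PrimeTheory
    extends : Γ ⊆ ⌊ world ⌋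
    avoids  : δ ∈ Δ → δ ∉ ⌊ world ⌋

module Lindenbaum (lem : ExcludedMiddle 0ℓ) {Γ₀ Δ : Theory}
                  (Δ-directed : Directed Δ) (Γ₀⊬Δ : ¬ Γ₀ ⊢⋁ Δ) where

  extend : Theory → Formula → Theory
  extend Γ χ = Γ ∪ (λ ψ → χ ≡ ψ × ¬ Γ ∪ ｛ χ ｝ ⊢⋁ Δ)

  stage : ℕ → Theory
  stage zero    = Γ₀
  stage (suc n) = extend (stage n) (enumerate n)

  limit : Theory
  limit = ⋃ ℕ stage

  extend-⊬ : ¬ Γ ⊢⋁ Δ → ¬ extend Γ χ ⊢⋁ Δ
  extend-⊬ {Γ} {χ} Γ⊬Δ (δ , δ∈Δ , d) = Γ⊬Δ (δ , δ∈Δ , weaken extend⊆Γ d)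
    where
    -- d also derives δ from Γ ∪ ｛ χ ｝, so χ was not added.
    extend⊆Γ : extend Γ χ ⊆ Γ
    extend⊆Γ (inj₁ ψ∈Γ)        = ψ∈Γ
    extend⊆Γ (inj₂ (_ , Γχ⊬Δ)) = ⊥-elim (Γχ⊬Δ (δ , δ∈Δ , weaken (Sum.map id proj₁) d))

  stage-⊬ : ∀ n → ¬ stage n ⊢⋁ Δ
  stage-⊬ zero    = Γ₀⊬Δ
  stage-⊬ (suc n) = extend-⊬ (stage-⊬ n)

  stage-mono : ∀ {m n} → m ≤ n → stage m ⊆ stage n
  stage-mono = go ∘ ≤⇒≤′
    where
    go : ∀ {m n} → m ≤′ n → stage m ⊆ stage n
    go ≤′-refl     = id
    go (≤′-step h) = inj₁ ∘ go h

  compact : limit ⊢ φ → ∃[ n ] (stage n ⊢ φ)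
  compact (hyp (n , φ∈stage)) = n , hyp φ∈stage
  compact (thm t)             = zero , thm t
  compact (mp d e) with m , d′ ← compact d | n , e′ ← compact e =
    m ⊔ n , mp (weaken (stage-mono (m≤m⊔n m n)) d′) (weaken (stage-mono (m≤n⊔m m n)) e′)

  limit-⊬ : ¬ limit ⊢⋁ Δ
  limit-⊬ (δ , δ∈Δ , d) with n , d′ ← compact d = stage-⊬ n (δ , δ∈Δ , d′)

  limit-decides : ∀ φ → φ ∈ limit ⊎ limit ∪ ｛ φ ｝ ⊢⋁ Δ
  limit-decides φ with m , refl ← enumerate-surjective φ | lem {stage m ∪ ｛ enumerate m ｝ ⊢⋁ Δ}
  ... | yes (δ , δ∈Δ , d) = inj₂ (δ , δ∈Δ , weaken (Sum.map (m ,_) id) d)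
  ... | no ⊬Δ             = inj₁ (suc m , inj₂ (refl , ⊬Δ))

  limit-closed : limit ⊢ φ → φ ∈ limit
  limit-closed {φ} d with limit-decides φ
  ... | inj₁ φ∈limit          = φ∈limit
  ... | inj₂ (δ , δ∈Δ , e) = ⊥-elim (limit-⊬ (δ , δ∈Δ , cut d e))

  limit-prime : (φ ∨' ψ) ∈ limit → φ ∈ limit ⊎ ψ ∈ limit
  limit-prime {φ} {ψ} φ∨ψ∈limit with limit-decides φ | limit-decides ψ
  ... | inj₁ φ∈limit | _            = inj₁ φ∈limit
  ... | _            | inj₁ ψ∈limit = inj₂ ψ∈limit
  ... | inj₂ (δ₁ , δ₁∈Δ , d₁) | inj₂ (δ₂ , δ₂∈Δ , d₂)
    with δ , δ∈Δ , t ← Δ-directed δ₁∈Δ δ₂∈Δ =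
    ⊥-elim (limit-⊬ (δ , δ∈Δ , mp (thm t) (∨-elim (hyp φ∨ψ∈limit) (∨-introˡ d₁) (∨-introʳ d₂))))

  lindenbaum : δ ∈ Δ → PrimeExtension Γ₀ Δ
  lindenbaum δ∈Δ = record
    { world   = record
      { holds  = λ φ → isYes (lem {φ ∈ limit})
      ; closed = λ d → fromWitness (limit-closed (weaken toWitness d))
      ; prime  = λ h → Sum.map fromWitness fromWitness (limit-prime (toWitness h))
      ; ⊥-free = λ h → limit-⊬ (_ , δ∈Δ , ex-falso (hyp (toWitness h)))
      }
    ; extends = λ φ∈Γ₀ → fromWitness (zero , φ∈Γ₀)
    ; avoids  = λ δ∈Δ h → limit-⊬ (_ , δ∈Δ , hyp (toWitness h))
    }

module _ {F : Frame} where
  open Frame F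
  open Sem F
  open Equivalence using (to; from)

  infix 4 _⊨[_]_
  _⊨[_]_ : X → Valuation → Formula → Set
  x ⊨[ V ] φ = _⊨_ V x φ

  _∘ᵛ_ : Valuation → Subst → Valuation
  (V ∘ᵛ σ) n = ⟦_⟧ V (σ n)

  R-resp-⇔ : ∀ {a b x y} → (∀ z → Upset.pred a z ⇔ Upset.pred b z) → R a x y → R b x y
  R-resp-⇔ {a} {b} a⇔b = R-ext a b (λ z → to (a⇔b z)) (λ z → from (a⇔b z))

  ⊨-subst : ∀ V σ φ {x} → x ⊨[ V ] φ [ σ ] ⇔ x ⊨[ V ∘ᵛ σ ] φ
  ⊨-subst V σ (var n)  = mk⇔ id id
  ⊨-subst V σ ⊥'       = mk⇔ id id
  ⊨-subst V σ (φ ∧' ψ) = mk⇔ (Product.map (to (⊨-subst V σ φ)) (to (⊨-subst V σ ψ)))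
                             (Product.map (from (⊨-subst V σ φ)) (from (⊨-subst V σ ψ)))
  ⊨-subst V σ (φ ∨' ψ) = mk⇔ (Sum.map (to (⊨-subst V σ φ)) (to (⊨-subst V σ ψ)))
                             (Sum.map (from (⊨-subst V σ φ)) (from (⊨-subst V σ ψ)))
  ⊨-subst V σ (φ ⇒ ψ)  = mk⇔ (λ h y x≤y → to (⊨-subst V σ ψ) ∘ h y x≤y ∘ from (⊨-subst V σ φ))
                             (λ h y x≤y → from (⊨-subst V σ ψ) ∘ h y x≤y ∘ to (⊨-subst V σ φ))
  ⊨-subst V σ (φ ▷ ψ)  =
    mk⇔ (λ h y xRy → to (⊨-subst V σ ψ) (h y (R-resp-⇔ (λ _ → ⇔.sym (⊨-subst V σ φ)) xRy)))
        (λ h y xRy → from (⊨-subst V σ ψ) (h y (R-resp-⇔ (λ _ → ⊨-subst V σ φ) xRy)))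

  module Soundness (F∈ : InClass F) where
    open InClass F∈

    ipc-valid : ∀ {θ} → IPCAxiom θ → ∀ V x → x ⊨[ V ] θ
    ipc-valid ax-K   V _ _ _ a z y≤z _ = persist V p y≤z a
    ipc-valid ax-S   V _ _ _ f z y≤z g w z≤w a = f w (≤-trans y≤z z≤w) a w ≤-refl (g w z≤w a)
    ipc-valid ax-∧E₁ V _ _ _ (a , _) = a
    ipc-valid ax-∧E₂ V _ _ _ (_ , b) = b
    ipc-valid ax-∧I  V _ _ _ a z y≤z b = persist V p y≤z a , b
    ipc-valid ax-∨I₁ V _ _ _ = inj₁
    ipc-valid ax-∨I₂ V _ _ _ = inj₂
    ipc-valid ax-∨E  V _ _ _ f z y≤z g w z≤w = [ f w (≤-trans y≤z z≤w) , g w z≤w ]′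
    ipc-valid ax-efq V _ _ _ ()

    ick-valid : ∀ {θ} → ICKAxiom θ → ∀ V x → x ⊨[ V ] θ
    ick-valid ax-C∧ V _ = (λ _ _ h → (λ z r → proj₁ (h z r)) , (λ z r → proj₂ (h z r)))
                        , (λ _ _ (h₁ , h₂) z r → h₁ z r , h₂ z r)
    ick-valid ax-C⊤ V _ = (λ _ _ _ _ _ ()) , (λ _ _ _ _ _ _ _ ())

    sICL-valid : ∀ {θ} → sICLAxiom θ → ∀ V x → x ⊨[ V ] θ
    sICL-valid ax-1 V _ _ _ a z yRz = persist V q (R⊆≤ _ yRz) a
    sICL-valid ax-2 V _ _ _ h z yRz with u , v , yRu , uRv , v≤z ← R-dense _ yRz = persist V q v≤z (h u yRu v uRv)

    ⇔-valid : (∀ V x → x ⊨[ V ] φ ⇔' ψ) → ∀ V x → x ⊨[ V ] φ ⇔ x ⊨[ V ] ψ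
    ⇔-valid h V x = mk⇔ (proj₁ (h V x) x ≤-refl) (proj₂ (h V x) x ≤-refl)

    sound : sICL φ → ∀ V x → x ⊨[ V ] φ
    sound (ipc ax)             = ipc-valid ax
    sound (ick ax)             = ick-valid ax
    sound (extra ax)           = sICL-valid ax
    sound (usubst {φ} σ d) V x = from (⊨-subst V σ φ) (sound d (V ∘ᵛ σ) x)
    sound (mp d e) V x         = sound d V x x ≤-refl (sound e V x)
    sound (congˡ {φ} {ψ} d) V x =
        (λ _ _ h z r → h z (R-resp-⇔ (⇔.sym ∘ φ⇔ψ) r))
      , (λ _ _ h z r → h z (R-resp-⇔ φ⇔ψ r))
      where
      φ⇔ψ : ∀ w → w ⊨[ V ] φ ⇔ w ⊨[ V ] ψ
      φ⇔ψ = ⇔-valid {φ} {ψ} (sound d) V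
    sound (congʳ {φ} {ψ} d) V x =
        (λ _ _ h z r → to (φ⇔ψ z) (h z r))
      , (λ _ _ h z r → from (φ⇔ψ z) (h z r))
      where
      φ⇔ψ : ∀ w → w ⊨[ V ] φ ⇔ w ⊨[ V ] ψ
      φ⇔ψ = ⇔-valid {φ} {ψ} (sound d) V

soundness : sICL φ → ∀ F → InClass F → Valid F φ
soundness d F F∈ = Soundness.sound F∈ d

one-point-frame : Frame
one-point-frame = record
  { X = Unit ; _≤_ = λ _ _ → Unit ; ≤-refl = tt ; ≤-trans = λ _ _ → tt ; inhabitant = tt
  ; R = λ _ _ _ → ⊥ ; R-ext = λ _ _ _ _ → id ; R-back = λ _ _ () }

sICL-consistent : ¬ sICL ⊥'
sICL-consistent d =
  soundness d one-point-frame record { R⊆≤ = λ _ () ; R-dense = λ _ () } (λ _ → mkUpset (λ _ → Unit) _) tt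

module Completeness (lem : ExcludedMiddle 0ℓ) where
  open Equivalence using (to; from)
  open PrimeTheory using (closed; prime; ⊥-free)

  ⊢-by-extensions : (∀ w → Γ ⊆ ⌊ w ⌋ → ψ ∈ ⌊ w ⌋) → Γ ⊢ ψ
  ⊢-by-extensions {Γ} {ψ} h with lem {Γ ⊢ ψ}
  ... | yes Γ⊢ψ = Γ⊢ψ
  ... | no Γ⊬ψ  = ⊥-elim (avoids refl (h world extends))
    where open PrimeExtension (Lindenbaum.lindenbaum lem {Γ} ｛｝-directed (Γ⊬ψ ∘ ⊢⋁-｛｝) refl)

  entails : (∀ w → φ ∈ ⌊ w ⌋ → ψ ∈ ⌊ w ⌋) → sICL (φ ⇒ ψ)
  entails h = ⊢-theorem (deduction (⊢-by-extensions (λ w ∅φ⊆w → h w (∅φ⊆w (inj₂ refl)))))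

  _⊑_ : PrimeTheory → PrimeTheory → Set
  w ⊑ v = ⌊ w ⌋ ⊆ ⌊ v ⌋

  Defines : Formula → Upset _⊑_ → Set
  Defines φ a = ∀ w → Upset.pred a w ⇔ φ ∈ ⌊ w ⌋

  -- Upsets that are not the truth set of a formula relate nothing.
  Rᶜ : Upset _⊑_ → PrimeTheory → PrimeTheory → Set
  Rᶜ a w v = ∃[ φ ] Defines φ a × consequents φ ⌊ w ⌋ ⊆ ⌊ v ⌋

  some-prime-theory : PrimeTheory
  some-prime-theory = PrimeExtension.world
    (Lindenbaum.lindenbaum lem {∅} ｛｝-directed (sICL-consistent ∘ ⊢-theorem ∘ ⊢⋁-｛｝) refl)

  canonical : Frame
  canonical = record
    { X = PrimeTheory ; _≤_ = _⊑_ ; ≤-refl = id ; ≤-trans = λ u⊑v v⊑w → v⊑w ∘ u⊑v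
    ; inhabitant = some-prime-theory
    ; R = Rᶜ
    ; R-ext = λ a b a⊆b b⊆a (φ , φ-defines-a , sub) →
        φ , (λ w → mk⇔ (to (φ-defines-a w) ∘ b⊆a w) (a⊆b w ∘ from (φ-defines-a w))) , sub
    ; R-back = λ a {z = v} w⊑u (φ , φ-defines-a , sub) → v , (φ , φ-defines-a , λ m → sub (w⊑u m)) , id
    }

  Rᶜ-dense : ∀ a {w v} → Rᶜ a w v → ∃[ u ] ∃[ v′ ] (Rᶜ a w u × Rᶜ a u v′ × v′ ⊑ v)
  Rᶜ-dense a {w} {v} (φ , φ-defines-a , sub) =
    world , v , (φ , φ-defines-a , extends) , (φ , φ-defines-a , u⊆v) , id
    where
    Refuted : Theory
    Refuted δ = ∃[ χ ] δ ≡ (φ ▷ χ) × χ ∉ ⌊ v ⌋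

    refuted-directed : Directed Refuted
    refuted-directed (χ₁ , refl , χ₁∉v) (χ₂ , refl , χ₂∉v) =
      (φ ▷ (χ₁ ∨' χ₂)) , (χ₁ ∨' χ₂ , refl , [ χ₁∉v , χ₂∉v ]′ ∘ prime v)
                     , ⊢-theorem (deduction (▷-∨ assumption))

    consequents⊬refuted : ¬ consequents φ ⌊ w ⌋ ⊢⋁ Refuted
    consequents⊬refuted (_ , (χ , refl , χ∉v) , d) = χ∉v (sub (closed w (▷-idem (consequents-⊢ d))))

    open PrimeExtension (Lindenbaum.lindenbaum lem refuted-directed consequents⊬refuted (⊥' , refl , ⊥-free v))

    u⊆v : consequents φ ⌊ world ⌋ ⊆ ⌊ v ⌋
    u⊆v φ▷χ∈u = decidable-stable (T? _) (λ χ∉v → avoids (_ , refl , χ∉v) φ▷χ∈u)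

  canonical-in-class : InClass canonical
  canonical-in-class = record
    { R⊆≤     = λ _ {w} (φ , _ , sub) ψ∈w → sub (closed w (▷-intro (hyp ψ∈w)))
    ; R-dense = Rᶜ-dense
    }

  Vᶜ : Sem.Valuation canonical
  Vᶜ n = mkUpset (λ w → var n ∈ ⌊ w ⌋) (λ w⊑v → w⊑v)

  truth : ∀ φ w → w ⊨[ Vᶜ ] φ ⇔ φ ∈ ⌊ w ⌋
  truth (var n)  w = mk⇔ id id
  truth ⊥'       w = mk⇔ (λ ()) (⊥-free w)
  truth (φ ∧' ψ) w = mk⇔
    (λ (a , b) → closed w (∧-intro (hyp (to (truth φ w) a)) (hyp (to (truth ψ w) b))))
    (λ m → from (truth φ w) (closed w (∧-elimˡ (hyp m))) , from (truth ψ w) (closed w (∧-elimʳ (hyp m))))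
  truth (φ ∨' ψ) w = mk⇔
    [ (λ a → closed w (∨-introˡ (hyp (to (truth φ w) a))))
    , (λ b → closed w (∨-introʳ (hyp (to (truth ψ w) b)))) ]′
    (Sum.map (from (truth φ w)) (from (truth ψ w)) ∘ prime w)
  truth (φ ⇒ ψ)  w = mk⇔
    (λ h → closed w (deduction (⊢-by-extensions λ v wφ⊆v →
      to (truth ψ v) (h v (λ {_} m → wφ⊆v (inj₁ m)) (from (truth φ v) (wφ⊆v (inj₂ refl)))))))
    (λ m v w⊑v a → from (truth ψ v) (closed v (mp (hyp (w⊑v m)) (hyp (to (truth φ v) a)))))
  truth (φ ▷ ψ)  w = mk⇔
    (λ h → closed w (consequents-⊢ (⊢-by-extensions λ v sub → to (truth ψ v) (h v (φ , truth φ , sub)))))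
    (λ m v wRv → from (truth ψ v) (consequent-holds m {v} wRv))
    where
    consequent-holds : (φ ▷ ψ) ∈ ⌊ w ⌋ → ∀ {v} → Rᶜ (Sem.⟦_⟧ canonical Vᶜ φ) w v → ψ ∈ ⌊ v ⌋
    consequent-holds m (φ′ , φ′-defines , sub) = sub (closed w (▷-congˡ φ⇔φ′ (hyp m)))
      where
      φ⇔φ′ : sICL (φ ⇔' φ′)
      φ⇔φ′ = ⇔-theorem (entails (λ u → to (φ′-defines u) ∘ from (truth φ u)))
                       (entails (λ u → to (truth φ u) ∘ from (φ′-defines u)))

  completeness : (∀ F → InClass F → Valid F φ) → sICL φ
  completeness {φ} valid =
    ⊢-theorem (⊢-by-extensions λ w _ → to (truth φ w) (valid canonical canonical-in-class Vᶜ w))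

theorem7p17 : ExcludedMiddle 0ℓ → ∀ (φ : Formula) → (sICL φ → ∀ (F : Frame) → InClass F → Valid F φ) × ((∀ (F : Frame) → InClass F → Valid F φ) → sICL φ)
theorem7p17 lem φ = soundness , Completeness.completeness lem
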